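{- For every relational algebra expression $e$, there exists a type formula that is principal for $e$, and such a principal type formula can be effectively computed from $e$.
   Context: Fix infinite supplies of relation variables, attribute names, and type variables. A type is a finite set of attribute names. For a finite set $S$ of relation variables, a type assignment on $S$ is a map $\mathcal{T}$ assigning to each $r\in S$ a type $\mathcal{T}(r)$. Relational algebra expressions are generated by the grammar $e \to r \mid (e\cup e)\mid (e-e)\mid (e\Join e)\mid (e\times e)\mid \sigma_{\theta(A_1,\ldots,A_n)}(e)\mid \pi_{A_1,\ldots,A_n}(e)\mid \rho_{A/B}(e)\mid \widehat{\pi}_A(e)$, where $r$ is a relation variable, $A,B,A_i$ are attribute names and $\theta$ is a selection predicate. ${\it Relvars}(e)$ is the set of relation variables occurring in $e$. Typing: for a type assignment $\mathcal{T}$ on a set containing ${\it Relvars}(e)$ and a type $\tau$, the judgment $\mathcal{T}\vdash e:\tau$ is defined inductively: $\mathcal{T}\vdash r:\mathcal{T}(r)$; if $\mathcal{T}\vdash e_1:\tau$ and $\mathcal{T}\vdash e_2:\tau$ then $\mathcal{T}\vdash (e_1\cup e_2):\tau$ and $\mathcal{T}\vdash(e_1-e_2):\tau$; if $\mathcal{T}\vdash e_1:\tau_1$ and $\mathcal{T}\vdash e_2:\tau_2$ then $\mathcal{T}\vdash (e_1\Join e_2):\tau_1\cup\tau_2$, and if moreover $\tau_1\cap\tau_2=\emptyset$ then $\mathcal{T}\vdash(e_1\times e_2):\tau_1\cup\tau_2$; if $\mathcal{T}\vdash e:\tau$ and $A_1,\ldots,A_n\in\tau$ then $\mathcal{T}\vdash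 \sigma_{\theta(A_1,\ldots,A_n)}(e):\tau$ and $\mathcal{T}\vdash\pi_{A_1,\ldots,A_n}(e):\{A_1,\ldots,A_n\}$; if $\mathcal{T}\vdash e:\tau$, $A\in\tau$, $B\notin\tau$ then $\mathcal{T}\vdash\rho_{A/B}(e):(\tau-\{A\})\cup\{B\}$; if $\mathcal{T}\vdash e:\tau$ and $A\in\tau$ then $\mathcal{T}\vdash\widehat{\pi}_A(e):\tau-\{A\}$. A type context $\Gamma$ consists of: a finite set ${\it Relvars}$ of relation variables; a finite set ${\it Typevars}$ of type variables; a map ${\it decl}:{\it Relvars}\to 2^{{\it Typevars}}$; a finite set ${\it Specattrs}$ of attribute names (special attributes); and a map ${\it constraint}$ assigning to each special attribute a propositional Boolean formula whose propositional variables are elements of ${\it Relvars}$. An instantiation of $\Gamma$ is a map $\mathcal{I}$ on ${\it Typevars}\cup{\it Specattrs}$ such that: each type variable $a$ is mapped to a type $\mathcal{I}(a)$, with $\mathcal{I}(a_1)\cap\mathcal{I}(a_2)=\emptyset$ for distinct type variables $a_1,a_2$ and $A\notin\mathcal{I}(a)$ for every type variable $a$ and special attribute $A$; and each special attribute $A$ is mapped to a subset $\mathcal{I}(A)\subseteq{\it Relvars}$ such that the truth assignment making exactly the variables in $\mathcal{I}(A)$ true satisfies ${\it constraint}(A)$ (written $\mathcal{I}(A)\models{\it constraint}(A)$). The image $\mathcal{I}(\Gamma)$ is the type assignment on ${\it Relvars}$ with $\mathcal{I}(\Gamma)(r)=\bigcup\{\mathcal{I}(a)\mid a\in{\it decl}(r)\}\cup\{A\in{\it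 Specattrs}\mid r\in\mathcal{I}(A)\}$. A type formula is a quadruple $(\Gamma,e,{\it Outvars},{\it outatt})$ where $\Gamma$ is a type context, $e$ is an expression with ${\it Relvars}(e)={\it Relvars}(\Gamma)$ and ${\it Specattrs}(\Gamma)$ containing every attribute name explicitly occurring in $e$, ${\it Outvars}\subseteq{\it Typevars}(\Gamma)$, and ${\it outatt}$ assigns to each special attribute a Boolean formula over ${\it Relvars}(\Gamma)$. For an instantiation $\mathcal{I}$ of $\Gamma$, the output type of the type formula under $\mathcal{I}$ is $\bigcup\{\mathcal{I}(a)\mid a\in{\it Outvars}\}\cup\{A\in{\it Specattrs}\mid \mathcal{I}(A)\models{\it outatt}(A)\}$. A type formula $(\Gamma,e,{\it Outvars},{\it outatt})$ is principal for $e$ if for every type assignment $\mathcal{T}$ on ${\it Relvars}(e)$ and every type $\tau$: $\mathcal{T}\vdash e:\tau$ holds if and only if there is an instantiation $\mathcal{I}$ of $\Gamma$ with $\mathcal{I}(\Gamma)=\mathcal{T}$ and with $\tau$ equal to the output type of the type formula under $\mathcal{I}$. (In particular, if $e$ is well-typed under no type assignment, any type formula whose type context has no instantiation is principal for $e$.) -}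

module Defs where

open import Data.Nat using (ℕ; _≡ᵇ_)
open import Data.Bool using (Bool; true; false; not; _∧_; _∨_; if_then_else_)
open import Data.List using (List; []; _∷_; _++_; concatMap)
open import Data.Bool.ListAction using (any)
open import Data.List.Membership.Propositional using (_∈_; _∉_)
open import Data.List.Relation.Unary.All using (All)
open import Data.Product using (Σ; _×_; _,_)
open import Data.Sum using (_⊎_)
open import Data.Empty using (⊥)
open import Relation.Binary.PropositionalEquality using (_≡_; _≢_)
open import Function.Bundles using (_⇔_)

RelVar : Set
RelVar = ℕ

Attr : Set
Attr = ℕ

TypeVar : Set
TypeVar = ℕ

-- names of (opaque) selection predicates θ
PredName : Set
PredName = ℕ

_⊆_ : List ℕ → List ℕ → Set
s ⊆ t = ∀ x → x ∈ s → x ∈ t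

_≐_ : List ℕ → List ℕ → Set
s ≐ t = (s ⊆ t) × (t ⊆ s)

Disjoint : List ℕ → List ℕ → Set
Disjoint s t = ∀ x → x ∈ s → x ∈ t → ⊥

member : ℕ → List ℕ → Bool
member x = any (λ y → x ≡ᵇ y)

filterᵇ : {A : Set} → (A → Bool) → List A → List A
filterᵇ p [] = []
filterᵇ p (x ∷ xs) = if p x then x ∷ filterᵇ p xs else filterᵇ p xs

-- A type is a finite set of attribute names (a list, up to _≐_).
Type : Set
Type = List Attr

-- A type assignment; only its values on the relevant finite set of
-- relation variables matter.
TypeAssignment : Set
TypeAssignment = RelVar → Type

data Expr : Set where
  rv     : RelVar → Expr
  _∪ₑ_   : Expr → Expr → Expr
  _−ₑ_   : Expr → Expr → Expr
  _⋈ₑ_   : Expr → Expr → Expr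
  _×ₑ_   : Expr → Expr → Expr
  σ      : PredName → List Attr → Expr → Expr
  π      : List Attr → Expr → Expr
  ρ      : Attr → Attr → Expr → Expr
  πhat   : Attr → Expr → Expr

Relvars : Expr → List RelVar
Relvars (rv r) = r ∷ []
Relvars (e₁ ∪ₑ e₂) = Relvars e₁ ++ Relvars e₂
Relvars (e₁ −ₑ e₂) = Relvars e₁ ++ Relvars e₂
Relvars (e₁ ⋈ₑ e₂) = Relvars e₁ ++ Relvars e₂
Relvars (e₁ ×ₑ e₂) = Relvars e₁ ++ Relvars e₂
Relvars (σ θ As e) = Relvars e
Relvars (π As e) = Relvars e
Relvars (ρ A B e) = Relvars e
Relvars (πhat A e) = Relvars e

Attrs : Expr → List Attr
Attrs (rv r) = []
Attrs (e₁ ∪ₑ e₂) = Attrs e₁ ++ Attrs e₂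
Attrs (e₁ −ₑ e₂) = Attrs e₁ ++ Attrs e₂
Attrs (e₁ ⋈ₑ e₂) = Attrs e₁ ++ Attrs e₂
Attrs (e₁ ×ₑ e₂) = Attrs e₁ ++ Attrs e₂
Attrs (σ θ As e) = As ++ Attrs e
Attrs (π As e) = As ++ Attrs e
Attrs (ρ A B e) = A ∷ B ∷ Attrs e
Attrs (πhat A e) = A ∷ Attrs e

-- Typing judgment  T ⊢ e ∶ τ  (types are sets, so conclusions are
-- stated up to extensional set equality _≐_)

data _⊢_∶_ (T : TypeAssignment) : Expr → Type → Set where
  ⊢rv   : ∀ {r τ} → τ ≐ T r → T ⊢ rv r ∶ τ
  ⊢∪    : ∀ {e₁ e₂ τ} → T ⊢ e₁ ∶ τ → T ⊢ e₂ ∶ τ → T ⊢ (e₁ ∪ₑ e₂) ∶ τ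
  ⊢−    : ∀ {e₁ e₂ τ} → T ⊢ e₁ ∶ τ → T ⊢ e₂ ∶ τ → T ⊢ (e₁ −ₑ e₂) ∶ τ
  ⊢⋈    : ∀ {e₁ e₂ τ₁ τ₂ τ} → T ⊢ e₁ ∶ τ₁ → T ⊢ e₂ ∶ τ₂ →
          τ ≐ (τ₁ ++ τ₂) → T ⊢ (e₁ ⋈ₑ e₂) ∶ τ
  ⊢×    : ∀ {e₁ e₂ τ₁ τ₂ τ} → T ⊢ e₁ ∶ τ₁ → T ⊢ e₂ ∶ τ₂ →
          Disjoint τ₁ τ₂ → τ ≐ (τ₁ ++ τ₂) → T ⊢ (e₁ ×ₑ e₂) ∶ τ
  ⊢σ    : ∀ {θ As e τ} → T ⊢ e ∶ τ → All (_∈ τ) As → T ⊢ σ θ As e ∶ τ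
  ⊢π    : ∀ {As e τ τ'} → T ⊢ e ∶ τ → All (_∈ τ) As → τ' ≐ As →
          T ⊢ π As e ∶ τ'
  ⊢ρ    : ∀ {A B e τ τ'} → T ⊢ e ∶ τ → A ∈ τ → B ∉ τ →
          (∀ x → (x ∈ τ' → (x ∈ τ × x ≢ A) ⊎ x ≡ B) ×
                 ((x ∈ τ × x ≢ A) ⊎ x ≡ B → x ∈ τ')) →
          T ⊢ ρ A B e ∶ τ'
  ⊢πhat : ∀ {A e τ τ'} → T ⊢ e ∶ τ → A ∈ τ →
          (∀ x → (x ∈ τ' → x ∈ τ × x ≢ A) × (x ∈ τ × x ≢ A → x ∈ τ')) →
          T ⊢ πhat A e ∶ τ'

data Formula : Set where
  fvar  : RelVar → Formula
  ftrue fFalse : Formula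
  fnot  : Formula → Formula
  fand for : Formula → Formula → Formula

fvars : Formula → List RelVar
fvars (fvar r) = r ∷ []
fvars ftrue = []
fvars fFalse = []
fvars (fnot φ) = fvars φ
fvars (fand φ ψ) = fvars φ ++ fvars ψ
fvars (for φ ψ) = fvars φ ++ fvars ψ

eval : (RelVar → Bool) → Formula → Bool
eval v (fvar r) = v r
eval v ftrue = true
eval v fFalse = false
eval v (fnot φ) = not (eval v φ)
eval v (fand φ ψ) = eval v φ ∧ eval v ψ
eval v (for φ ψ) = eval v φ ∨ eval v ψ

_⊨_ : List RelVar → Formula → Set
S ⊨ φ = eval (λ r → member r S) φ ≡ true

record TypeContext : Set where
  field
    relvars    : List RelVar
    typevars   : List TypeVar
    decl       : RelVar → List TypeVar
    specattrs  : List Attr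
    constraint : Attr → Formula
open TypeContext public

WellFormedContext : TypeContext → Set
WellFormedContext Γ =
  (∀ r → r ∈ relvars Γ → decl Γ r ⊆ typevars Γ) ×
  (∀ A → A ∈ specattrs Γ → fvars (constraint Γ A) ⊆ relvars Γ)

-- an instantiation: a map on Typevars ∪ Specattrs, given by its two parts
record Instantiation : Set where
  field
    tyOf  : TypeVar → Type
    relOf : Attr → List RelVar
open Instantiation public

IsInstantiation : TypeContext → Instantiation → Set
IsInstantiation Γ I =
  (∀ a₁ a₂ → a₁ ∈ typevars Γ → a₂ ∈ typevars Γ → a₁ ≢ a₂ →
     Disjoint (tyOf I a₁) (tyOf I a₂)) ×
  (∀ a A → a ∈ typevars Γ → A ∈ specattrs Γ → A ∉ tyOf I a) ×
  (∀ A → A ∈ specattrs Γ → relOf I A ⊆ relvars Γ) ×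
  (∀ A → A ∈ specattrs Γ → relOf I A ⊨ constraint Γ A)

image : TypeContext → Instantiation → TypeAssignment
image Γ I r =
  concatMap (tyOf I) (decl Γ r) ++
  filterᵇ (λ A → member r (relOf I A)) (specattrs Γ)

record TypeFormula : Set where
  field
    ctx     : TypeContext
    expr    : Expr
    outvars : List TypeVar
    outatt  : Attr → Formula
open TypeFormula public

IsTypeFormula : TypeFormula → Set
IsTypeFormula F =
  WellFormedContext (ctx F) ×
  (Relvars (expr F) ≐ relvars (ctx F)) ×
  (Attrs (expr F) ⊆ specattrs (ctx F)) ×
  (outvars F ⊆ typevars (ctx F)) ×
  (∀ A → A ∈ specattrs (ctx F) → fvars (outatt F A) ⊆ relvars (ctx F))

outputType : TypeFormula → Instantiation → Type
outputType F I =
  concatMap (tyOf I) (outvars F) ++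
  filterᵇ (λ A → eval (λ r → member r (relOf I A)) (outatt F A))
          (specattrs (ctx F))

-- F is principal for e (F is assumed to be a type formula with expr F ≡ e)
Principal : TypeFormula → Expr → Set
Principal F e =
  ∀ (T : TypeAssignment) (τ : Type) →
    (T ⊢ e ∶ τ) ⇔
    Σ Instantiation (λ I →
       IsInstantiation (ctx F) I ×
       (∀ r → r ∈ Relvars e → image (ctx F) I r ≐ T r) ×
       (τ ≐ outputType F I))

-- Typing is attribute-wise: 𝒯 ⊢ e ∶ τ holds iff for every attribute x the formula typableAt e x
-- holds at the valuation r ↦ (x ∈ 𝒯 r), and τ consists of the x at which outputAt e x holds there.
-- These formulas depend on x only through its equalities with the names occurring in e, so all
-- other attributes share one pair of formulas. The principal type formula makes the names of e
-- special attributes, constrained by their own formulas, and has one type variable for each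
-- valuation of the relation variables satisfying the shared typability formula, declared in the
-- relations that valuation makes true and output when the shared output formula holds there.
-- A type assignment is the image of the instantiation sending every other attribute to the type
-- variable of its valuation, and conversely every instantiation yields valuations of this kind.

module Submission where

open import Defs
open import Data.Bool using (Bool; true; false; T; not; _∧_; _∨_; if_then_else_)
open import Data.Bool.Properties using (T-∧; T-∨; T-≡)
open import Data.Empty using (⊥-elim)
open import Data.List using (List; []; _∷_; _++_; concatMap; upTo)
open import Data.List.Membership.Propositional using (_∈_; _∉_; find; lose)
open import Data.List.Membership.Propositional.Properties
  using (∈-++⁺ˡ; ∈-++⁺ʳ; ∈-++⁻; ∈-concatMap⁺; ∈-concatMap⁻; ∈-upTo⁺)
open import Data.List.Relation.Unary.Any as Any using (here; there; any?)
open import Data.List.Relation.Unary.Any.Properties using (any⁺; any⁻)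
import Data.List.Relation.Unary.All as All
open import Data.Maybe using (Maybe; just; nothing)
open import Data.Nat using (ℕ; zero; suc; _+_; _≤_; z≤n; s≤s; ⌊_/2⌋)
open import Data.Nat.Properties using (_≟_; ≡ᵇ⇒≡; ≡⇒≡ᵇ; ≤-refl; +-mono-≤)
open import Data.List.Membership.DecPropositional _≟_ using (_∈?_; _∉?_)
open import Data.Product using (Σ; _×_; _,_; proj₁; proj₂)
import Data.Product as Product
open import Data.Product.Function.NonDependent.Propositional using (_×-⇔_)
open import Data.Sum using (_⊎_; inj₁; inj₂; [_,_])
import Data.Sum as Sum
open import Data.Unit using (tt)
open import Function using (_∘_; const; _⇔_; mk⇔; Equivalence)
open import Function.Construct.Composition using (_⇔-∘_)
open import Function.Construct.Symmetry using (⇔-sym)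
open import Function.Construct.Identity using (⇔-id)
open import Function.Related.TypeIsomorphisms using (→-cong-⇔; ¬-cong-⇔)
open import Relation.Nullary using (¬_; yes; no; does; proof)
open import Relation.Nullary.Reflects using (Reflects; ofʸ; ofⁿ)
open import Relation.Nullary.Decidable using (Dec; dec-false)
open import Relation.Binary.PropositionalEquality
  using (_≡_; _≢_; refl; sym; trans; cong; cong₂; subst; module ≡-Reasoning)

open Equivalence using (to; from)

T-injective : ∀ {a b} → T a ⇔ T b → a ≡ b
T-injective {false} {false} _ = refl
T-injective {false} {true}  a⇔b = ⊥-elim (from a⇔b tt)
T-injective {true}  {false} a⇔b = ⊥-elim (to a⇔b tt)
T-injective {true}  {true}  _ = refl

T-not⇔ : ∀ {a} → T (not a) ⇔ (¬ T a)
T-not⇔ {false} = mk⇔ (λ _ ()) (const tt)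
T-not⇔ {true} = mk⇔ (λ ()) (λ ¬a → ¬a tt)

pointwise : ∀ {P Q : Set} → (P → Q) × (Q → P) → P ⇔ Q
pointwise (p , q) = mk⇔ p q

T-does : ∀ {P : Set} (p? : Dec P) → T (does p?) ⇔ P
T-does (yes p) = mk⇔ (const p) (const tt)
T-does (no ¬p) = mk⇔ (λ ()) ¬p

member⇔∈ : ∀ {x} xs → T (member x xs) ⇔ x ∈ xs
member⇔∈ {x} xs =
  mk⇔ (Any.map (λ {y} → ≡ᵇ⇒≡ x y) ∘ any⁻ _ xs)
      (any⁺ _ ∘ Any.map (λ {y} → ≡⇒≡ᵇ x y))

member≡ : ∀ {x xs b} → x ∈ xs ⇔ T b → member x xs ≡ b
member≡ {xs = xs} x∈⇔ = T-injective (x∈⇔ ⇔-∘ member⇔∈ xs)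

∉⇒member≡false : ∀ {x xs} → x ∉ xs → member x xs ≡ false
∉⇒member≡false x∉ = member≡ (mk⇔ x∉ λ ())

∈-filterᵇ⁻ : ∀ {A : Set} (p : A → Bool) {x} xs → x ∈ filterᵇ p xs → x ∈ xs × T (p x)
∈-filterᵇ⁻ p (y ∷ xs) x∈ with p y in eq
∈-filterᵇ⁻ p (y ∷ xs) (here refl) | true = here refl , subst T (sym eq) tt
∈-filterᵇ⁻ p (y ∷ xs) (there x∈) | true = Product.map₁ there (∈-filterᵇ⁻ p xs x∈)
∈-filterᵇ⁻ p (y ∷ xs) x∈ | false = Product.map₁ there (∈-filterᵇ⁻ p xs x∈)

∈-filterᵇ⁺ : ∀ {A : Set} (p : A → Bool) {x xs} → x ∈ xs → T (p x) → x ∈ filterᵇ p xs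
∈-filterᵇ⁺ p {xs = y ∷ xs} (here refl) px with p y
... | true = here refl
∈-filterᵇ⁺ p {xs = y ∷ xs} (there x∈) px with p y
... | true = there (∈-filterᵇ⁺ p x∈ px)
... | false = ∈-filterᵇ⁺ p x∈ px

[]-⊆ : ∀ {ys} → [] ⊆ ys
[]-⊆ _ ()

++-⊆ : ∀ {xs ys zs} → xs ⊆ zs → ys ⊆ zs → (xs ++ ys) ⊆ zs
++-⊆ {xs} xs⊆ ys⊆ x x∈ = [ xs⊆ x , ys⊆ x ] (∈-++⁻ xs x∈)

⊆-++ˡ : ∀ {xs ys} zs → xs ⊆ ys → xs ⊆ (ys ++ zs)
⊆-++ˡ zs xs⊆ x = ∈-++⁺ˡ ∘ xs⊆ x

⊆-++ʳ : ∀ {xs zs} ys → xs ⊆ zs → xs ⊆ (ys ++ zs)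
⊆-++ʳ ys xs⊆ x = ∈-++⁺ʳ ys ∘ xs⊆ x

Valuation : Set
Valuation = RelVar → Bool

Agree : List RelVar → Valuation → Valuation → Set
Agree R v w = ∀ r → r ∈ R → v r ≡ w r

eval-cong : ∀ φ {R v w} → fvars φ ⊆ R → Agree R v w → eval v φ ≡ eval w φ
eval-cong (fvar r) φ⊆ v≗w = v≗w r (φ⊆ r (here refl))
eval-cong ftrue φ⊆ v≗w = refl
eval-cong fFalse φ⊆ v≗w = refl
eval-cong (fnot φ) φ⊆ v≗w = cong not (eval-cong φ φ⊆ v≗w)
eval-cong (fand φ ψ) φψ⊆ v≗w =
  cong₂ _∧_ (eval-cong φ (λ r → φψ⊆ r ∘ ∈-++⁺ˡ) v≗w)
            (eval-cong ψ (λ r → φψ⊆ r ∘ ∈-++⁺ʳ (fvars φ)) v≗w)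
eval-cong (for φ ψ) φψ⊆ v≗w =
  cong₂ _∨_ (eval-cong φ (λ r → φψ⊆ r ∘ ∈-++⁺ˡ) v≗w)
            (eval-cong ψ (λ r → φψ⊆ r ∘ ∈-++⁺ʳ (fvars φ)) v≗w)

bool : Bool → Formula
bool b = if b then ftrue else fFalse

infixr 4 _⇒ᶠ_
_⇒ᶠ_ : Bool → Formula → Formula
c ⇒ᶠ φ = if c then φ else ftrue

_⇔ᶠ_ : Formula → Formula → Formula
φ ⇔ᶠ ψ = for (fand φ ψ) (fand (fnot φ) (fnot ψ))

eval-bool : ∀ v b → eval v (bool b) ≡ b
eval-bool v false = refl
eval-bool v true = refl

⇒ᶠ⇔ : ∀ {P : Set} (p? : Dec P) {v φ} → T (eval v (does p? ⇒ᶠ φ)) ⇔ (P → T (eval v φ))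
⇒ᶠ⇔ (yes p) = mk⇔ const (λ f → f p)
⇒ᶠ⇔ (no ¬p) = mk⇔ (λ _ → ⊥-elim ∘ ¬p) (const tt)

eval-⇔ᶠ : ∀ {v} φ ψ → T (eval v (φ ⇔ᶠ ψ)) ⇔ (eval v φ ≡ eval v ψ)
eval-⇔ᶠ {v} φ ψ with eval v φ | eval v ψ
... | false | false = mk⇔ (const refl) (const tt)
... | false | true = mk⇔ (λ ()) (λ ())
... | true | false = mk⇔ (λ ()) (λ ())
... | true | true = mk⇔ (const refl) (const tt)

fvars-if : ∀ c {φ ψ R} → fvars φ ⊆ R → fvars ψ ⊆ R → fvars (if c then φ else ψ) ⊆ R
fvars-if false φ⊆ ψ⊆ = ψ⊆
fvars-if true φ⊆ ψ⊆ = φ⊆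

fvars-⇔ᶠ : ∀ φ ψ {R} → fvars φ ⊆ R → fvars ψ ⊆ R → fvars (φ ⇔ᶠ ψ) ⊆ R
fvars-⇔ᶠ φ ψ φ⊆ ψ⊆ = ++-⊆ (++-⊆ φ⊆ ψ⊆) (++-⊆ φ⊆ ψ⊆)

-- An attribute is either a specific name `just x` or `nothing`, which stands for
-- every name not occurring in the expression at hand.
infix 6 _is_ _isIn_
_is_ : Maybe Attr → Attr → Bool
nothing is A = false
just x is A = does (x ≟ A)

_isIn_ : Maybe Attr → List Attr → Bool
nothing isIn As = false
just x isIn As = does (x ∈? As)

-- At the valuation r ↦ (x ∈ 𝒯 r), outputAt e (just x) holds iff x belongs to the type of e,
-- and typableAt e (just x) iff the side conditions of the typing rules hold for x.
outputAt : Expr → Maybe Attr → Formula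
outputAt (rv r) a = fvar r
outputAt (e₁ ∪ₑ e₂) a = outputAt e₁ a
outputAt (e₁ −ₑ e₂) a = outputAt e₁ a
outputAt (e₁ ⋈ₑ e₂) a = for (outputAt e₁ a) (outputAt e₂ a)
outputAt (e₁ ×ₑ e₂) a = for (outputAt e₁ a) (outputAt e₂ a)
outputAt (σ θ As e) a = outputAt e a
outputAt (π As e) a = bool (a isIn As)
outputAt (ρ A B e) a = if a is B then ftrue else if a is A then fFalse else outputAt e a
outputAt (πhat A e) a = if a is A then fFalse else outputAt e a

typableAt : Expr → Maybe Attr → Formula
typableAt (rv r) a = ftrue
typableAt (e₁ ∪ₑ e₂) a =
  fand (typableAt e₁ a) (fand (typableAt e₂ a) (outputAt e₁ a ⇔ᶠ outputAt e₂ a))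
typableAt (e₁ −ₑ e₂) a =
  fand (typableAt e₁ a) (fand (typableAt e₂ a) (outputAt e₁ a ⇔ᶠ outputAt e₂ a))
typableAt (e₁ ⋈ₑ e₂) a = fand (typableAt e₁ a) (typableAt e₂ a)
typableAt (e₁ ×ₑ e₂) a =
  fand (typableAt e₁ a) (fand (typableAt e₂ a) (fnot (fand (outputAt e₁ a) (outputAt e₂ a))))
typableAt (σ θ As e) a = fand (typableAt e a) (a isIn As ⇒ᶠ outputAt e a)
typableAt (π As e) a = fand (typableAt e a) (a isIn As ⇒ᶠ outputAt e a)
typableAt (ρ A B e) a =
  fand (typableAt e a) (fand (a is A ⇒ᶠ outputAt e a) (a is B ⇒ᶠ fnot (outputAt e a)))
typableAt (πhat A e) a = fand (typableAt e a) (a is A ⇒ᶠ outputAt e a)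

fvars-outputAt : ∀ e a → fvars (outputAt e a) ⊆ Relvars e
fvars-outputAt (rv r) a = λ _ r∈ → r∈
fvars-outputAt (e₁ ∪ₑ e₂) a = ⊆-++ˡ (Relvars e₂) (fvars-outputAt e₁ a)
fvars-outputAt (e₁ −ₑ e₂) a = ⊆-++ˡ (Relvars e₂) (fvars-outputAt e₁ a)
fvars-outputAt (e₁ ⋈ₑ e₂) a =
  ++-⊆ (⊆-++ˡ (Relvars e₂) (fvars-outputAt e₁ a)) (⊆-++ʳ (Relvars e₁) (fvars-outputAt e₂ a))
fvars-outputAt (e₁ ×ₑ e₂) a =
  ++-⊆ (⊆-++ˡ (Relvars e₂) (fvars-outputAt e₁ a)) (⊆-++ʳ (Relvars e₁) (fvars-outputAt e₂ a))
fvars-outputAt (σ θ As e) a = fvars-outputAt e a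
fvars-outputAt (π As e) a = fvars-if (a isIn As) []-⊆ []-⊆
fvars-outputAt (ρ A B e) a = fvars-if (a is B) []-⊆ (fvars-if (a is A) []-⊆ (fvars-outputAt e a))
fvars-outputAt (πhat A e) a = fvars-if (a is A) []-⊆ (fvars-outputAt e a)

fvars-typableAt : ∀ e a → fvars (typableAt e a) ⊆ Relvars e
fvars-typableAt (rv r) a = []-⊆
fvars-typableAt (e₁ ∪ₑ e₂) a =
  ++-⊆ (⊆-++ˡ (Relvars e₂) (fvars-typableAt e₁ a))
       (++-⊆ (⊆-++ʳ (Relvars e₁) (fvars-typableAt e₂ a))
             (fvars-⇔ᶠ (outputAt e₁ a) (outputAt e₂ a)
                       (fvars-outputAt (e₁ ∪ₑ e₂) a)
                       (⊆-++ʳ (Relvars e₁) (fvars-outputAt e₂ a))))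
fvars-typableAt (e₁ −ₑ e₂) a =
  ++-⊆ (⊆-++ˡ (Relvars e₂) (fvars-typableAt e₁ a))
       (++-⊆ (⊆-++ʳ (Relvars e₁) (fvars-typableAt e₂ a))
             (fvars-⇔ᶠ (outputAt e₁ a) (outputAt e₂ a)
                       (fvars-outputAt (e₁ −ₑ e₂) a)
                       (⊆-++ʳ (Relvars e₁) (fvars-outputAt e₂ a))))
fvars-typableAt (e₁ ⋈ₑ e₂) a =
  ++-⊆ (⊆-++ˡ (Relvars e₂) (fvars-typableAt e₁ a)) (⊆-++ʳ (Relvars e₁) (fvars-typableAt e₂ a))
fvars-typableAt (e₁ ×ₑ e₂) a =
  ++-⊆ (⊆-++ˡ (Relvars e₂) (fvars-typableAt e₁ a))
       (++-⊆ (⊆-++ʳ (Relvars e₁) (fvars-typableAt e₂ a)) (fvars-outputAt (e₁ ×ₑ e₂) a))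
fvars-typableAt (σ θ As e) a =
  ++-⊆ (fvars-typableAt e a) (fvars-if (a isIn As) (fvars-outputAt e a) []-⊆)
fvars-typableAt (π As e) a =
  ++-⊆ (fvars-typableAt e a) (fvars-if (a isIn As) (fvars-outputAt e a) []-⊆)
fvars-typableAt (ρ A B e) a =
  ++-⊆ (fvars-typableAt e a)
       (++-⊆ (fvars-if (a is A) (fvars-outputAt e a) []-⊆)
             (fvars-if (a is B) (fvars-outputAt e a) []-⊆))
fvars-typableAt (πhat A e) a =
  ++-⊆ (fvars-typableAt e a) (fvars-if (a is A) (fvars-outputAt e a) []-⊆)

is-fresh : ∀ {x A} → x ≢ A → just x is A ≡ false
is-fresh {x} {A} = dec-false (x ≟ A)

isIn-fresh : ∀ {x} As → x ∉ As → just x isIn As ≡ false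
isIn-fresh {x} As = dec-false (x ∈? As)

outputAt-generic : ∀ e {x} → x ∉ Attrs e → outputAt e (just x) ≡ outputAt e nothing
outputAt-generic (rv r) x∉ = refl
outputAt-generic (e₁ ∪ₑ e₂) x∉ = outputAt-generic e₁ (x∉ ∘ ∈-++⁺ˡ)
outputAt-generic (e₁ −ₑ e₂) x∉ = outputAt-generic e₁ (x∉ ∘ ∈-++⁺ˡ)
outputAt-generic (e₁ ⋈ₑ e₂) x∉ =
  cong₂ for (outputAt-generic e₁ (x∉ ∘ ∈-++⁺ˡ))
            (outputAt-generic e₂ (x∉ ∘ ∈-++⁺ʳ (Attrs e₁)))
outputAt-generic (e₁ ×ₑ e₂) x∉ =
  cong₂ for (outputAt-generic e₁ (x∉ ∘ ∈-++⁺ˡ))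
            (outputAt-generic e₂ (x∉ ∘ ∈-++⁺ʳ (Attrs e₁)))
outputAt-generic (σ θ As e) x∉ = outputAt-generic e (x∉ ∘ ∈-++⁺ʳ As)
outputAt-generic (π As e) x∉ = cong bool (isIn-fresh As (x∉ ∘ ∈-++⁺ˡ))
outputAt-generic (ρ A B e) x∉
  rewrite is-fresh (x∉ ∘ there ∘ here) | is-fresh (x∉ ∘ here) =
  outputAt-generic e (x∉ ∘ there ∘ there)
outputAt-generic (πhat A e) x∉ rewrite is-fresh (x∉ ∘ here) = outputAt-generic e (x∉ ∘ there)

typableAt-generic : ∀ e {x} → x ∉ Attrs e → typableAt e (just x) ≡ typableAt e nothing
typableAt-generic (rv r) x∉ = refl
typableAt-generic (e₁ ∪ₑ e₂) x∉ =
  cong₂ fand (typableAt-generic e₁ (x∉ ∘ ∈-++⁺ˡ))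
             (cong₂ fand (typableAt-generic e₂ (x∉ ∘ ∈-++⁺ʳ (Attrs e₁)))
                         (cong₂ _⇔ᶠ_ (outputAt-generic e₁ (x∉ ∘ ∈-++⁺ˡ))
                                     (outputAt-generic e₂ (x∉ ∘ ∈-++⁺ʳ (Attrs e₁)))))
typableAt-generic (e₁ −ₑ e₂) x∉ =
  cong₂ fand (typableAt-generic e₁ (x∉ ∘ ∈-++⁺ˡ))
             (cong₂ fand (typableAt-generic e₂ (x∉ ∘ ∈-++⁺ʳ (Attrs e₁)))
                         (cong₂ _⇔ᶠ_ (outputAt-generic e₁ (x∉ ∘ ∈-++⁺ˡ))
                                     (outputAt-generic e₂ (x∉ ∘ ∈-++⁺ʳ (Attrs e₁)))))
typableAt-generic (e₁ ⋈ₑ e₂) x∉ =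
  cong₂ fand (typableAt-generic e₁ (x∉ ∘ ∈-++⁺ˡ))
             (typableAt-generic e₂ (x∉ ∘ ∈-++⁺ʳ (Attrs e₁)))
typableAt-generic (e₁ ×ₑ e₂) x∉ =
  cong₂ fand (typableAt-generic e₁ (x∉ ∘ ∈-++⁺ˡ))
             (cong₂ fand (typableAt-generic e₂ (x∉ ∘ ∈-++⁺ʳ (Attrs e₁)))
                         (cong fnot (cong₂ fand (outputAt-generic e₁ (x∉ ∘ ∈-++⁺ˡ))
                                                (outputAt-generic e₂ (x∉ ∘ ∈-++⁺ʳ (Attrs e₁))))))
typableAt-generic (σ θ As e) x∉ rewrite isIn-fresh As (x∉ ∘ ∈-++⁺ˡ) =
  cong₂ fand (typableAt-generic e (x∉ ∘ ∈-++⁺ʳ As)) refl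
typableAt-generic (π As e) x∉ rewrite isIn-fresh As (x∉ ∘ ∈-++⁺ˡ) =
  cong₂ fand (typableAt-generic e (x∉ ∘ ∈-++⁺ʳ As)) refl
typableAt-generic (ρ A B e) x∉ rewrite is-fresh (x∉ ∘ here) | is-fresh (x∉ ∘ there ∘ here) =
  cong₂ fand (typableAt-generic e (x∉ ∘ there ∘ there)) refl
typableAt-generic (πhat A e) x∉ rewrite is-fresh (x∉ ∘ here) =
  cong₂ fand (typableAt-generic e (x∉ ∘ there)) refl

nowhere : Valuation
nowhere _ = false

output-nowhere : ∀ e → eval nowhere (outputAt e nothing) ≡ false
output-nowhere (rv r) = refl
output-nowhere (e₁ ∪ₑ e₂) = output-nowhere e₁
output-nowhere (e₁ −ₑ e₂) = output-nowhere e₁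
output-nowhere (e₁ ⋈ₑ e₂) = cong₂ _∨_ (output-nowhere e₁) (output-nowhere e₂)
output-nowhere (e₁ ×ₑ e₂) = cong₂ _∨_ (output-nowhere e₁) (output-nowhere e₂)
output-nowhere (σ θ As e) = output-nowhere e
output-nowhere (π As e) = refl
output-nowhere (ρ A B e) = output-nowhere e
output-nowhere (πhat A e) = output-nowhere e

typable-nowhere : ∀ e → eval nowhere (typableAt e nothing) ≡ true
typable-nowhere (rv r) = refl
typable-nowhere (e₁ ∪ₑ e₂)
  rewrite typable-nowhere e₁ | typable-nowhere e₂ | output-nowhere e₁ | output-nowhere e₂ = refl
typable-nowhere (e₁ −ₑ e₂)
  rewrite typable-nowhere e₁ | typable-nowhere e₂ | output-nowhere e₁ | output-nowhere e₂ = refl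
typable-nowhere (e₁ ⋈ₑ e₂) rewrite typable-nowhere e₁ | typable-nowhere e₂ = refl
typable-nowhere (e₁ ×ₑ e₂)
  rewrite typable-nowhere e₁ | typable-nowhere e₂ | output-nowhere e₁ = refl
typable-nowhere (σ θ As e) rewrite typable-nowhere e = refl
typable-nowhere (π As e) rewrite typable-nowhere e = refl
typable-nowhere (ρ A B e) rewrite typable-nowhere e = refl
typable-nowhere (πhat A e) rewrite typable-nowhere e = refl

typable-absent : ∀ e {x v} → x ∉ Attrs e → Agree (Relvars e) v nowhere →
  T (eval v (typableAt e (just x)))
typable-absent e {x} {v} x∉ v≗nowhere = from T-≡ (begin
  eval v (typableAt e (just x))
    ≡⟨ cong (eval v) (typableAt-generic e x∉) ⟩
  eval v (typableAt e nothing)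
    ≡⟨ eval-cong (typableAt e nothing) (fvars-typableAt e nothing) v≗nowhere ⟩
  eval nowhere (typableAt e nothing)
    ≡⟨ typable-nowhere e ⟩
  true ∎)
  where open ≡-Reasoning

output-absent : ∀ e {x v} → x ∉ Attrs e → Agree (Relvars e) v nowhere →
  eval v (outputAt e (just x)) ≡ false
output-absent e {x} {v} x∉ v≗nowhere = begin
  eval v (outputAt e (just x))
    ≡⟨ cong (eval v) (outputAt-generic e x∉) ⟩
  eval v (outputAt e nothing)
    ≡⟨ eval-cong (outputAt e nothing) (fvars-outputAt e nothing) v≗nowhere ⟩
  eval nowhere (outputAt e nothing)
    ≡⟨ output-nowhere e ⟩
  false ∎
  where open ≡-Reasoning

occurrences : TypeAssignment → Attr → Valuation
occurrences 𝒯 x r = member x (𝒯 r)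

typable : Expr → TypeAssignment → Attr → Bool
typable e 𝒯 x = eval (occurrences 𝒯 x) (typableAt e (just x))

output : Expr → TypeAssignment → Attr → Bool
output e 𝒯 x = eval (occurrences 𝒯 x) (outputAt e (just x))

Represents : Type → (Attr → Bool) → Set
Represents τ f = ∀ x → x ∈ τ ⇔ T (f x)

module _ {f : Attr → Bool} where

  ≐-represents : ∀ {τ τ′} → τ ≐ τ′ → Represents τ′ f → Represents τ f
  ≐-represents (τ⊆ , ⊆τ) rep x = mk⇔ (to (rep x) ∘ τ⊆ x) (⊆τ x ∘ from (rep x))

  represents-≐ : ∀ {τ τ′} → Represents τ f → Represents τ′ f → τ ≐ τ′
  represents-≐ rep rep′ =
    (λ x → from (rep′ x) ∘ to (rep x)) , (λ x → from (rep x) ∘ to (rep′ x))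

  represents-functional : ∀ {τ g} → Represents τ f → Represents τ g → ∀ x → f x ≡ g x
  represents-functional rep rep′ x = T-injective (rep′ x ⇔-∘ ⇔-sym (rep x))

  represents-cong : ∀ {τ g} → (∀ x → f x ≡ g x) → Represents τ f → Represents τ g
  represents-cong {τ} f≗g rep x = subst (λ b → x ∈ τ ⇔ T b) (f≗g x) (rep x)

  represents-++ : ∀ {τ₁ τ₂ g} → Represents τ₁ f → Represents τ₂ g →
    Represents (τ₁ ++ τ₂) (λ x → f x ∨ g x)
  represents-++ {τ₁} rep₁ rep₂ x =
    mk⇔ (from T-∨ ∘ Sum.map (to (rep₁ x)) (to (rep₂ x)) ∘ ∈-++⁻ τ₁)
        ([ ∈-++⁺ˡ ∘ from (rep₁ x) , ∈-++⁺ʳ τ₁ ∘ from (rep₂ x) ] ∘ to T-∨)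

represents-isIn : ∀ As → Represents As (λ x → does (x ∈? As))
represents-isIn As x = ⇔-sym (T-does (x ∈? As))

rename-output⇔ : ∀ {τ : Type} {v φ} {x A B : Attr} {b c} →
  Reflects (x ≡ B) b → Reflects (x ≡ A) c → (x ∈ τ ⇔ T (eval v φ)) →
  ((x ∈ τ × x ≢ A) ⊎ x ≡ B) ⇔ T (eval v (if b then ftrue else if c then fFalse else φ))
rename-output⇔ (ofʸ x≡B) _ _ = mk⇔ (const tt) (const (inj₂ x≡B))
rename-output⇔ (ofⁿ x≢B) (ofʸ x≡A) _ = mk⇔ [ (λ (_ , x≢A) → x≢A x≡A) , x≢B ] (λ ())
rename-output⇔ (ofⁿ x≢B) (ofⁿ x≢A) x∈τ⇔ =
  mk⇔ [ to x∈τ⇔ ∘ proj₁ , ⊥-elim ∘ x≢B ] (λ t → inj₁ (from x∈τ⇔ t , x≢A))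

drop-output⇔ : ∀ {τ : Type} {v φ} {x A : Attr} {c} →
  Reflects (x ≡ A) c → (x ∈ τ ⇔ T (eval v φ)) →
  (x ∈ τ × x ≢ A) ⇔ T (eval v (if c then fFalse else φ))
drop-output⇔ (ofʸ x≡A) _ = mk⇔ (λ (_ , x≢A) → x≢A x≡A) (λ ())
drop-output⇔ (ofⁿ x≢A) x∈τ⇔ = mk⇔ (to x∈τ⇔ ∘ proj₁) (λ t → from x∈τ⇔ t , x≢A)

module _ {𝒯 : TypeAssignment} where

  typable-∪⇔ : ∀ e₁ e₂ x → T (typable (e₁ ∪ₑ e₂) 𝒯 x) ⇔
    (T (typable e₁ 𝒯 x) × T (typable e₂ 𝒯 x) × output e₁ 𝒯 x ≡ output e₂ 𝒯 x)
  typable-∪⇔ e₁ e₂ x =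
    (⇔-id _ ×-⇔ ⇔-id _ ×-⇔ eval-⇔ᶠ (outputAt e₁ (just x)) (outputAt e₂ (just x)))
    ⇔-∘ ((⇔-id _ ×-⇔ T-∧) ⇔-∘ T-∧)

  typable-−⇔ : ∀ e₁ e₂ x → T (typable (e₁ −ₑ e₂) 𝒯 x) ⇔
    (T (typable e₁ 𝒯 x) × T (typable e₂ 𝒯 x) × output e₁ 𝒯 x ≡ output e₂ 𝒯 x)
  typable-−⇔ = typable-∪⇔

  typable-×⇔ : ∀ e₁ e₂ x → T (typable (e₁ ×ₑ e₂) 𝒯 x) ⇔
    (T (typable e₁ 𝒯 x) × T (typable e₂ 𝒯 x) ×
     ¬ (T (output e₁ 𝒯 x) × T (output e₂ 𝒯 x)))
  typable-×⇔ e₁ e₂ x =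
    (⇔-id _ ×-⇔ ⇔-id _ ×-⇔ (¬-cong-⇔ T-∧ ⇔-∘ T-not⇔))
    ⇔-∘ ((⇔-id _ ×-⇔ T-∧) ⇔-∘ T-∧)

  typable-σ⇔ : ∀ θ As e x → T (typable (σ θ As e) 𝒯 x) ⇔
    (T (typable e 𝒯 x) × (x ∈ As → T (output e 𝒯 x)))
  typable-σ⇔ θ As e x = (⇔-id _ ×-⇔ ⇒ᶠ⇔ (x ∈? As)) ⇔-∘ T-∧

  typable-π⇔ : ∀ As e x → T (typable (π As e) 𝒯 x) ⇔
    (T (typable e 𝒯 x) × (x ∈ As → T (output e 𝒯 x)))
  typable-π⇔ As e x = (⇔-id _ ×-⇔ ⇒ᶠ⇔ (x ∈? As)) ⇔-∘ T-∧

  typable-ρ⇔ : ∀ A B e x → T (typable (ρ A B e) 𝒯 x) ⇔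
    (T (typable e 𝒯 x) × (x ≡ A → T (output e 𝒯 x)) × (x ≡ B → ¬ T (output e 𝒯 x)))
  typable-ρ⇔ A B e x =
    (⇔-id _ ×-⇔ ⇒ᶠ⇔ (x ≟ A) ×-⇔ →-cong-⇔ (⇔-id _) T-not⇔ ⇔-∘ ⇒ᶠ⇔ (x ≟ B))
    ⇔-∘ ((⇔-id _ ×-⇔ T-∧) ⇔-∘ T-∧)

  typable-πhat⇔ : ∀ A e x → T (typable (πhat A e) 𝒯 x) ⇔
    (T (typable e 𝒯 x) × (x ≡ A → T (output e 𝒯 x)))
  typable-πhat⇔ A e x = (⇔-id _ ×-⇔ ⇒ᶠ⇔ (x ≟ A)) ⇔-∘ T-∧

  ⊢-sound : ∀ {e τ} → 𝒯 ⊢ e ∶ τ →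
    (∀ x → T (typable e 𝒯 x)) × Represents τ (output e 𝒯)
  ⊢-sound (⊢rv {r} (τ⊆ , ⊆τ)) =
    (λ _ → tt) ,
    λ x → mk⇔ (from (member⇔∈ (𝒯 r)) ∘ τ⊆ x) (⊆τ x ∘ to (member⇔∈ (𝒯 r)))
  ⊢-sound (⊢∪ {e₁} {e₂} d₁ d₂) with ⊢-sound d₁ | ⊢-sound d₂
  ... | t₁ , rep₁ | t₂ , rep₂ =
    (λ x → from (typable-∪⇔ e₁ e₂ x) (t₁ x , t₂ x , represents-functional rep₁ rep₂ x))
    , rep₁
  ⊢-sound (⊢− {e₁} {e₂} d₁ d₂) with ⊢-sound d₁ | ⊢-sound d₂
  ... | t₁ , rep₁ | t₂ , rep₂ =
    (λ x → from (typable-−⇔ e₁ e₂ x) (t₁ x , t₂ x , represents-functional rep₁ rep₂ x))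
    , rep₁
  ⊢-sound (⊢⋈ d₁ d₂ τ≐) with ⊢-sound d₁ | ⊢-sound d₂
  ... | t₁ , rep₁ | t₂ , rep₂ =
    (λ x → from T-∧ (t₁ x , t₂ x)) , ≐-represents τ≐ (represents-++ rep₁ rep₂)
  ⊢-sound (⊢× {e₁} {e₂} d₁ d₂ disjoint τ≐) with ⊢-sound d₁ | ⊢-sound d₂
  ... | t₁ , rep₁ | t₂ , rep₂ =
    (λ x → from (typable-×⇔ e₁ e₂ x)
             (t₁ x , t₂ x ,
              λ (o₁ , o₂) → disjoint x (from (rep₁ x) o₁) (from (rep₂ x) o₂)))
    , ≐-represents τ≐ (represents-++ rep₁ rep₂)
  ⊢-sound (⊢σ {θ} {As} {e} d As⊆τ) with ⊢-sound d
  ... | t , rep = (λ x → from (typable-σ⇔ θ As e x) (t x , to (rep x) ∘ All.lookup As⊆τ)) , rep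
  ⊢-sound (⊢π {As} {e} d As⊆τ τ≐As) with ⊢-sound d
  ... | t , rep =
    (λ x → from (typable-π⇔ As e x) (t x , to (rep x) ∘ All.lookup As⊆τ))
    , ≐-represents τ≐As (represents-cong (λ x → sym (eval-bool _ _)) (represents-isIn As))
  ⊢-sound (⊢ρ {A} {B} {e} d A∈τ B∉τ spec) with ⊢-sound d
  ... | t , rep =
    (λ x → from (typable-ρ⇔ A B e x)
             (t x , (λ { refl → to (rep A) A∈τ }) , λ { refl → B∉τ ∘ from (rep B) }))
    , λ x → rename-output⇔ (proof (x ≟ B)) (proof (x ≟ A)) (rep x) ⇔-∘ pointwise (spec x)
  ⊢-sound (⊢πhat {A} {e} d A∈τ spec) with ⊢-sound d
  ... | t , rep =
    (λ x → from (typable-πhat⇔ A e x) (t x , λ { refl → to (rep A) A∈τ }))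
    , λ x → drop-output⇔ (proof (x ≟ A)) (rep x) ⇔-∘ pointwise (spec x)

  canonical : Expr → Type
  canonical e = filterᵇ (output e 𝒯) (Attrs e ++ concatMap 𝒯 (Relvars e))

  canonical-represents : ∀ e → Represents (canonical e) (output e 𝒯)
  canonical-represents e x =
    mk⇔ (proj₂ ∘ ∈-filterᵇ⁻ (output e 𝒯) (Attrs e ++ concatMap 𝒯 (Relvars e)))
        (λ t → ∈-filterᵇ⁺ (output e 𝒯) (support t) t)
    where
    support : T (output e 𝒯 x) → x ∈ Attrs e ++ concatMap 𝒯 (Relvars e)
    support t with x ∈? (Attrs e ++ concatMap 𝒯 (Relvars e))
    ... | yes x∈ = x∈
    ... | no x∉ = ⊥-elim (subst T (output-absent e (x∉ ∘ ∈-++⁺ˡ) nowhere-in-𝒯) t)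
      where
      nowhere-in-𝒯 : Agree (Relvars e) (occurrences 𝒯 x) nowhere
      nowhere-in-𝒯 r r∈ =
        ∉⇒member≡false (x∉ ∘ ∈-++⁺ʳ (Attrs e) ∘ ∈-concatMap⁺ 𝒯 ∘ lose r∈)

  -- The type of the whole expression does not determine those of its subexpressions,
  -- so the induction goes through the canonical ones.
  ⊢-complete : ∀ e {τ} →
    (∀ x → T (typable e 𝒯 x)) → Represents τ (output e 𝒯) → 𝒯 ⊢ e ∶ τ
  ⊢-complete (rv r) t rep =
    ⊢rv ( (λ x → to (member⇔∈ (𝒯 r)) ∘ to (rep x))
        , (λ x → from (rep x) ∘ from (member⇔∈ (𝒯 r))))
  ⊢-complete (e₁ ∪ₑ e₂) t rep =
    ⊢∪ (⊢-complete e₁ (proj₁ ∘ parts) rep)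
       (⊢-complete e₂ (proj₁ ∘ proj₂ ∘ parts)
                      (represents-cong (proj₂ ∘ proj₂ ∘ parts) rep))
    where
    parts : ∀ x →
      T (typable e₁ 𝒯 x) × T (typable e₂ 𝒯 x) × output e₁ 𝒯 x ≡ output e₂ 𝒯 x
    parts x = to (typable-∪⇔ e₁ e₂ x) (t x)
  ⊢-complete (e₁ −ₑ e₂) t rep =
    ⊢− (⊢-complete e₁ (proj₁ ∘ parts) rep)
       (⊢-complete e₂ (proj₁ ∘ proj₂ ∘ parts)
                      (represents-cong (proj₂ ∘ proj₂ ∘ parts) rep))
    where
    parts : ∀ x →
      T (typable e₁ 𝒯 x) × T (typable e₂ 𝒯 x) × output e₁ 𝒯 x ≡ output e₂ 𝒯 x
    parts x = to (typable-−⇔ e₁ e₂ x) (t x)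
  ⊢-complete (e₁ ⋈ₑ e₂) t rep =
    ⊢⋈ (⊢-complete e₁ (proj₁ ∘ to T-∧ ∘ t) (canonical-represents e₁))
       (⊢-complete e₂ (proj₂ ∘ to T-∧ ∘ t) (canonical-represents e₂))
       (represents-≐ rep (represents-++ (canonical-represents e₁) (canonical-represents e₂)))
  ⊢-complete (e₁ ×ₑ e₂) t rep =
    ⊢× (⊢-complete e₁ (proj₁ ∘ parts) (canonical-represents e₁))
       (⊢-complete e₂ (proj₁ ∘ proj₂ ∘ parts) (canonical-represents e₂))
       (λ x x∈₁ x∈₂ → proj₂ (proj₂ (parts x))
                        (to (canonical-represents e₁ x) x∈₁ , to (canonical-represents e₂ x) x∈₂))
       (represents-≐ rep (represents-++ (canonical-represents e₁) (canonical-represents e₂)))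
    where
    parts : ∀ x →
      T (typable e₁ 𝒯 x) × T (typable e₂ 𝒯 x) × ¬ (T (output e₁ 𝒯 x) × T (output e₂ 𝒯 x))
    parts x = to (typable-×⇔ e₁ e₂ x) (t x)
  ⊢-complete (σ θ As e) t rep =
    ⊢σ (⊢-complete e (proj₁ ∘ parts) rep)
       (All.tabulate λ {A} A∈ → from (rep A) (proj₂ (parts A) A∈))
    where
    parts : ∀ x → T (typable e 𝒯 x) × (x ∈ As → T (output e 𝒯 x))
    parts x = to (typable-σ⇔ θ As e x) (t x)
  ⊢-complete (π As e) t rep =
    ⊢π (⊢-complete e (proj₁ ∘ parts) (canonical-represents e))
       (All.tabulate λ {A} A∈ → from (canonical-represents e A) (proj₂ (parts A) A∈))
       (represents-≐ rep (represents-cong (λ x → sym (eval-bool _ _)) (represents-isIn As)))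
    where
    parts : ∀ x → T (typable e 𝒯 x) × (x ∈ As → T (output e 𝒯 x))
    parts x = to (typable-π⇔ As e x) (t x)
  ⊢-complete (ρ A B e) t rep =
    ⊢ρ (⊢-complete e (proj₁ ∘ parts) (canonical-represents e))
       (from (canonical-represents e A) (proj₁ (proj₂ (parts A)) refl))
       (proj₂ (proj₂ (parts B)) refl ∘ to (canonical-represents e B))
       (λ x → let x∈⇔ = ⇔-sym (rename-output⇔ (proof (x ≟ B)) (proof (x ≟ A))
                                              (canonical-represents e x))
                         ⇔-∘ rep x
              in to x∈⇔ , from x∈⇔)
    where
    parts : ∀ x →
      T (typable e 𝒯 x) × (x ≡ A → T (output e 𝒯 x)) × (x ≡ B → ¬ T (output e 𝒯 x))
    parts x = to (typable-ρ⇔ A B e x) (t x)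
  ⊢-complete (πhat A e) t rep =
    ⊢πhat (⊢-complete e (proj₁ ∘ parts) (canonical-represents e))
          (from (canonical-represents e A) (proj₂ (parts A) refl))
          (λ x → let x∈⇔ = ⇔-sym (drop-output⇔ (proof (x ≟ A)) (canonical-represents e x))
                            ⇔-∘ rep x
                 in to x∈⇔ , from x∈⇔)
    where
    parts : ∀ x → T (typable e 𝒯 x) × (x ≡ A → T (output e 𝒯 x))
    parts x = to (typable-πhat⇔ A e x) (t x)

⊢⇔ : ∀ {𝒯 e τ} → 𝒯 ⊢ e ∶ τ ⇔ ((∀ x → T (typable e 𝒯 x)) × Represents τ (output e 𝒯))
⊢⇔ {e = e} = mk⇔ ⊢-sound (λ (t , rep) → ⊢-complete e t rep)

occurrences-agree : ∀ {R 𝒯 𝒯′} → (∀ r → r ∈ R → 𝒯 r ≐ 𝒯′ r) →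
  ∀ x → Agree R (occurrences 𝒯 x) (occurrences 𝒯′ x)
occurrences-agree {𝒯′ = 𝒯′} 𝒯≐𝒯′ x r r∈ =
  member≡ (⇔-sym (member⇔∈ (𝒯′ r)) ⇔-∘ pointwise (proj₁ (𝒯≐𝒯′ r r∈) x , proj₂ (𝒯≐𝒯′ r r∈) x))

typable-cong : ∀ e {𝒯 𝒯′} → (∀ r → r ∈ Relvars e → 𝒯 r ≐ 𝒯′ r) →
  ∀ x → typable e 𝒯 x ≡ typable e 𝒯′ x
typable-cong e 𝒯≐𝒯′ x =
  eval-cong (typableAt e (just x)) (fvars-typableAt e (just x)) (occurrences-agree 𝒯≐𝒯′ x)

output-cong : ∀ e {𝒯 𝒯′} → (∀ r → r ∈ Relvars e → 𝒯 r ≐ 𝒯′ r) →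
  ∀ x → output e 𝒯 x ≡ output e 𝒯′ x
output-cong e 𝒯≐𝒯′ x =
  eval-cong (outputAt e (just x)) (fvars-outputAt e (just x)) (occurrences-agree 𝒯≐𝒯′ x)

double : ℕ → ℕ
double zero = zero
double (suc n) = suc (suc (double n))

double-mono : ∀ {m n} → m ≤ n → double m ≤ double n
double-mono z≤n = z≤n
double-mono (s≤s m≤n) = s≤s (s≤s (double-mono m≤n))

bit : Bool → ℕ
bit false = 0
bit true = 1

bit-≤ : ∀ b → bit b ≤ bit true
bit-≤ false = z≤n
bit-≤ true = ≤-refl

lowBit : ℕ → Bool
lowBit zero = false
lowBit (suc zero) = true
lowBit (suc (suc n)) = lowBit n

lowBit-bit : ∀ b n → lowBit (bit b + double n) ≡ b
lowBit-bit false zero = refl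
lowBit-bit true zero = refl
lowBit-bit false (suc n) = lowBit-bit false n
lowBit-bit true (suc n) = lowBit-bit true n

⌊bit+double/2⌋≡ : ∀ b n → ⌊ bit b + double n /2⌋ ≡ n
⌊bit+double/2⌋≡ false zero = refl
⌊bit+double/2⌋≡ true zero = refl
⌊bit+double/2⌋≡ false (suc n) = cong suc (⌊bit+double/2⌋≡ false n)
⌊bit+double/2⌋≡ true (suc n) = cong suc (⌊bit+double/2⌋≡ true n)

encode : List RelVar → Valuation → ℕ
encode [] v = 0
encode (r ∷ R) v = bit (v r) + double (encode R v)

decode : List RelVar → ℕ → Valuation
decode [] i r = false
decode (d ∷ R) i r with r ≟ d
... | yes _ = lowBit i
... | no _ = decode R ⌊ i /2⌋ r

decode-encode : ∀ R v {r} → r ∈ R → decode R (encode R v) r ≡ v r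
decode-encode (d ∷ R) v {r} r∈ with r ≟ d
... | yes refl = lowBit-bit (v r) (encode R v)
... | no r≢d = begin
  decode R ⌊ bit (v d) + double (encode R v) /2⌋ r
    ≡⟨ cong (λ i → decode R i r) (⌊bit+double/2⌋≡ (v d) (encode R v)) ⟩
  decode R (encode R v) r
    ≡⟨ decode-encode R v (Any.tail r≢d r∈) ⟩
  v r ∎
  where open ≡-Reasoning

encode-≤ : ∀ R v → encode R v ≤ encode R (const true)
encode-≤ [] v = z≤n
encode-≤ (r ∷ R) v = +-mono-≤ (bit-≤ (v r)) (double-mono (encode-≤ R v))

indicator : List RelVar → Valuation
indicator S r = member r S

module _ (Γ : TypeContext) (I : Instantiation) {x : Attr} where

  ∈-image⁻ : ∀ {r} → x ∈ image Γ I r →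
    Σ TypeVar (λ a → a ∈ decl Γ r × x ∈ tyOf I a) ⊎ (x ∈ specattrs Γ × r ∈ relOf I x)
  ∈-image⁻ {r} x∈ with ∈-++⁻ (concatMap (tyOf I) (decl Γ r)) x∈
  ... | inj₁ x∈ty = inj₁ (find (∈-concatMap⁻ (tyOf I) x∈ty))
  ... | inj₂ x∈sp =
    inj₂ (Product.map₂ (to (member⇔∈ (relOf I x))) (∈-filterᵇ⁻ _ (specattrs Γ) x∈sp))

  ∈-image⁺ᵗʸ : ∀ {r a} → a ∈ decl Γ r → x ∈ tyOf I a → x ∈ image Γ I r
  ∈-image⁺ᵗʸ a∈ x∈ = ∈-++⁺ˡ (∈-concatMap⁺ (tyOf I) (lose a∈ x∈))

  ∈-image⁺ˢᵖ : ∀ {r} → x ∈ specattrs Γ → r ∈ relOf I x → x ∈ image Γ I r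
  ∈-image⁺ˢᵖ {r} x∈ r∈ =
    ∈-++⁺ʳ (concatMap (tyOf I) (decl Γ r)) (∈-filterᵇ⁺ _ x∈ (from (member⇔∈ (relOf I x)) r∈))

module _ (F : TypeFormula) (I : Instantiation) {x : Attr} where

  ∈-outputType⁻ : x ∈ outputType F I →
    Σ TypeVar (λ a → a ∈ outvars F × x ∈ tyOf I a) ⊎
    (x ∈ specattrs (ctx F) × T (eval (indicator (relOf I x)) (outatt F x)))
  ∈-outputType⁻ x∈ with ∈-++⁻ (concatMap (tyOf I) (outvars F)) x∈
  ... | inj₁ x∈ty = inj₁ (find (∈-concatMap⁻ (tyOf I) x∈ty))
  ... | inj₂ x∈sp = inj₂ (∈-filterᵇ⁻ _ (specattrs (ctx F)) x∈sp)

  ∈-outputType⁺ᵗʸ : ∀ {a} → a ∈ outvars F → x ∈ tyOf I a → x ∈ outputType F I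
  ∈-outputType⁺ᵗʸ a∈ x∈ = ∈-++⁺ˡ (∈-concatMap⁺ (tyOf I) (lose a∈ x∈))

  ∈-outputType⁺ˢᵖ : x ∈ specattrs (ctx F) → T (eval (indicator (relOf I x)) (outatt F x)) →
    x ∈ outputType F I
  ∈-outputType⁺ˢᵖ x∈ t = ∈-++⁺ʳ (concatMap (tyOf I) (outvars F)) (∈-filterᵇ⁺ _ x∈ t)

module PrincipalTypeFormula (e : Expr) where

  R : List RelVar
  R = Relvars e

  S : List Attr
  S = Attrs e

  -- The type variable i stands for the attributes outside e whose occurrence pattern
  -- r ↦ (x ∈ 𝒯 r) is decode R i; only the patterns allowed by the typing rules are kept.
  codes : List ℕ
  codes = upTo (suc (encode R (const true)))

  typeVariables : List TypeVar
  typeVariables = filterᵇ (λ i → eval (decode R i) (typableAt e nothing)) codes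

  Γ : TypeContext
  Γ = record
    { relvars = R
    ; typevars = typeVariables
    ; decl = λ r → filterᵇ (λ i → decode R i r) typeVariables
    ; specattrs = S
    ; constraint = typableAt e ∘ just
    }

  F : TypeFormula
  F = record
    { ctx = Γ
    ; expr = e
    ; outvars = filterᵇ (λ i → eval (decode R i) (outputAt e nothing)) typeVariables
    ; outatt = outputAt e ∘ just
    }

  isTypeFormula : IsTypeFormula F
  isTypeFormula =
    ( (λ _ _ i i∈ → proj₁ (∈-filterᵇ⁻ _ typeVariables i∈))
    , (λ A _ → fvars-typableAt e (just A)))
    , ((λ _ r∈ → r∈) , (λ _ r∈ → r∈))
    , (λ _ A∈ → A∈)
    , (λ i i∈ → proj₁ (∈-filterᵇ⁻ _ typeVariables i∈))
    , (λ A _ → fvars-outputAt e (just A))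

  ∈-typeVariables⁻ : ∀ {i} → i ∈ typeVariables → T (eval (decode R i) (typableAt e nothing))
  ∈-typeVariables⁻ = proj₂ ∘ ∈-filterᵇ⁻ (λ i → eval (decode R i) (typableAt e nothing)) codes

  ∈-decl⁻ : ∀ {r i} → i ∈ decl Γ r → i ∈ typeVariables × T (decode R i r)
  ∈-decl⁻ {r} = ∈-filterᵇ⁻ (λ i → decode R i r) typeVariables

  ∈-outvars⁻ : ∀ {i} → i ∈ outvars F →
    i ∈ typeVariables × T (eval (decode R i) (outputAt e nothing))
  ∈-outvars⁻ = ∈-filterᵇ⁻ (λ i → eval (decode R i) (outputAt e nothing)) typeVariables

  module _ {I : Instantiation} (isI : IsInstantiation Γ I) where

    Explains : Attr → Valuation → Set
    Explains x v =
      Agree R (occurrences (image Γ I) x) v × T (eval v (typableAt e (just x))) ×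
      (x ∈ outputType F I ⇔ T (eval v (outputAt e (just x))))

    special-explains : ∀ {x} → x ∈ S → Explains x (indicator (relOf I x))
    special-explains {x} x∈S = agree , from T-≡ (proj₂ (proj₂ (proj₂ isI)) x x∈S) , output⇔
      where
      x∉typevar : ∀ {a} → a ∈ typeVariables → x ∉ tyOf I a
      x∉typevar a∈ = proj₁ (proj₂ isI) _ x a∈ x∈S

      agree : Agree R (occurrences (image Γ I) x) (indicator (relOf I x))
      agree r _ = member≡ (⇔-sym (member⇔∈ (relOf I x)) ⇔-∘ x∈image⇔)
        where
        x∈image⇔ : x ∈ image Γ I r ⇔ r ∈ relOf I x
        x∈image⇔ =
          mk⇔ ([ (λ (_ , a∈ , x∈a) → ⊥-elim (x∉typevar (proj₁ (∈-decl⁻ a∈)) x∈a)) , proj₂ ]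
               ∘ ∈-image⁻ Γ I)
              (∈-image⁺ˢᵖ Γ I x∈S)

      output⇔ : x ∈ outputType F I ⇔ T (eval (indicator (relOf I x)) (outputAt e (just x)))
      output⇔ =
        mk⇔ ([ (λ (_ , a∈ , x∈a) → ⊥-elim (x∉typevar (proj₁ (∈-outvars⁻ a∈)) x∈a)) , proj₂ ]
             ∘ ∈-outputType⁻ F I)
            (∈-outputType⁺ˢᵖ F I x∈S)

    typevar-explains : ∀ {x i} → x ∉ S → i ∈ typeVariables → x ∈ tyOf I i →
      Explains x (decode R i)
    typevar-explains {x} {i} x∉S i∈ x∈i = agree , typable-i , output⇔
      where
      owner : ∀ {a} → a ∈ typeVariables → x ∈ tyOf I a → a ≡ i
      owner {a} a∈ x∈a with a ≟ i
      ... | yes a≡i = a≡i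
      ... | no a≢i = ⊥-elim (proj₁ isI a i a∈ i∈ a≢i x x∈a x∈i)

      declared : ∀ {a r} → a ∈ decl Γ r → x ∈ tyOf I a → T (decode R i r)
      declared {r = r} a∈ x∈a =
        let a∈tv , t = ∈-decl⁻ a∈ in subst (λ j → T (decode R j r)) (owner a∈tv x∈a) t

      output-i : ∀ {a} → a ∈ outvars F → x ∈ tyOf I a → T (eval (decode R i) (outputAt e nothing))
      output-i a∈ x∈a =
        let a∈tv , t = ∈-outvars⁻ a∈
        in subst (λ j → T (eval (decode R j) (outputAt e nothing))) (owner a∈tv x∈a) t

      agree : Agree R (occurrences (image Γ I) x) (decode R i)
      agree r _ = member≡ x∈image⇔
        where
        x∈image⇔ : x ∈ image Γ I r ⇔ T (decode R i r)
        x∈image⇔ =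
          mk⇔ ([ (λ (_ , a∈ , x∈a) → declared a∈ x∈a) , ⊥-elim ∘ x∉S ∘ proj₁ ] ∘ ∈-image⁻ Γ I)
              (λ t → ∈-image⁺ᵗʸ Γ I (∈-filterᵇ⁺ (λ j → decode R j r) i∈ t) x∈i)

      typable-i : T (eval (decode R i) (typableAt e (just x)))
      typable-i = subst (T ∘ eval (decode R i)) (sym (typableAt-generic e x∉S)) (∈-typeVariables⁻ i∈)

      output⇔ : x ∈ outputType F I ⇔ T (eval (decode R i) (outputAt e (just x)))
      output⇔ =
        subst (λ φ → x ∈ outputType F I ⇔ T (eval (decode R i) φ)) (sym (outputAt-generic e x∉S))
          (mk⇔ ([ (λ (_ , a∈ , x∈a) → output-i a∈ x∈a) , ⊥-elim ∘ x∉S ∘ proj₁ ] ∘ ∈-outputType⁻ F I)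
               (λ t → ∈-outputType⁺ᵗʸ F I (∈-filterᵇ⁺ (λ j → eval (decode R j) (outputAt e nothing)) i∈ t)
                                         x∈i))

    absent-explains : ∀ {x} → x ∉ S → (∀ i → i ∈ typeVariables → x ∉ tyOf I i) →
      Explains x nowhere
    absent-explains {x} x∉S x∉typevars = agree , typable-absent e x∉S (λ _ _ → refl) , output⇔
      where
      agree : Agree R (occurrences (image Γ I) x) nowhere
      agree r _ = ∉⇒member≡false
        ([ (λ (a , a∈ , x∈a) → x∉typevars a (proj₁ (∈-decl⁻ a∈)) x∈a) , x∉S ∘ proj₁ ] ∘ ∈-image⁻ Γ I)

      output⇔ : x ∈ outputType F I ⇔ T (eval nowhere (outputAt e (just x)))
      output⇔ =
        subst (λ b → x ∈ outputType F I ⇔ T b) (sym (output-absent e x∉S (λ _ _ → refl)))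
          (mk⇔ ([ (λ (a , a∈ , x∈a) → x∉typevars a (proj₁ (∈-outvars⁻ a∈)) x∈a) , x∉S ∘ proj₁ ]
                ∘ ∈-outputType⁻ F I)
               (λ ()))

    explanation : ∀ x → Σ Valuation (Explains x)
    explanation x with x ∈? S
    ... | yes x∈S = _ , special-explains x∈S
    ... | no x∉S with any? (λ i → x ∈? tyOf I i) typeVariables
    ...   | yes found = let i , i∈ , x∈i = find found in _ , typevar-explains x∉S i∈ x∈i
    ...   | no none = _ , absent-explains x∉S (λ i i∈ x∈i → none (lose i∈ x∈i))

    image-typable : ∀ x → T (typable e (image Γ I) x)
    image-typable x =
      let _ , agree , t , _ = explanation x
      in subst T (sym (eval-cong (typableAt e (just x)) (fvars-typableAt e (just x)) agree)) t

    outputType-represents : Represents (outputType F I) (output e (image Γ I))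
    outputType-represents x =
      let _ , agree , _ , output⇔ = explanation x
      in subst (λ b → x ∈ outputType F I ⇔ T b)
               (sym (eval-cong (outputAt e (just x)) (fvars-outputAt e (just x)) agree)) output⇔

  module _ {𝒯 : TypeAssignment} (t : ∀ x → T (typable e 𝒯 x)) where

    typevarOf : Attr → TypeVar
    typevarOf x = encode R (occurrences 𝒯 x)

    instantiation : Instantiation
    instantiation = record
      { tyOf = λ i → filterᵇ (λ x → does (x ∉? S) ∧ does (typevarOf x ≟ i)) (concatMap 𝒯 R)
      ; relOf = λ A → filterᵇ (λ r → member A (𝒯 r)) R
      }

    private
      I = instantiation

    ∈-tyOf⁻ : ∀ {x i} → x ∈ tyOf I i → x ∉ S × typevarOf x ≡ i
    ∈-tyOf⁻ {x} {i} x∈ =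
      Product.map (to (T-does (x ∉? S))) (to (T-does (typevarOf x ≟ i)))
                  (to T-∧ (proj₂ (∈-filterᵇ⁻ _ (concatMap 𝒯 R) x∈)))

    ∈-tyOf⁺ : ∀ {x r} → r ∈ R → x ∈ 𝒯 r → x ∉ S → x ∈ tyOf I (typevarOf x)
    ∈-tyOf⁺ {x} r∈ x∈ x∉S =
      ∈-filterᵇ⁺ _ (∈-concatMap⁺ 𝒯 (lose r∈ x∈))
                 (from T-∧ ( from (T-does (x ∉? S)) x∉S
                           , from (T-does (typevarOf x ≟ typevarOf x)) refl))

    ∈-relOf⇔ : ∀ {A r} → r ∈ R → r ∈ relOf I A ⇔ A ∈ 𝒯 r
    ∈-relOf⇔ {A} {r} r∈ =
      mk⇔ (to (member⇔∈ (𝒯 r)) ∘ proj₂ ∘ ∈-filterᵇ⁻ _ R)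
          (∈-filterᵇ⁺ _ r∈ ∘ from (member⇔∈ (𝒯 r)))

    decode-typevarOf : ∀ x → Agree R (decode R (typevarOf x)) (occurrences 𝒯 x)
    decode-typevarOf x r r∈ = decode-encode R (occurrences 𝒯 x) r∈

    typevarOf-∈ : ∀ {x} → x ∉ S → typevarOf x ∈ typeVariables
    typevarOf-∈ {x} x∉S =
      ∈-filterᵇ⁺ _ (∈-upTo⁺ (s≤s (encode-≤ R (occurrences 𝒯 x)))) (subst T (sym typable-code) (t x))
      where
      open ≡-Reasoning
      typable-code : eval (decode R (typevarOf x)) (typableAt e nothing) ≡ typable e 𝒯 x
      typable-code = begin
        eval (decode R (typevarOf x)) (typableAt e nothing)
          ≡⟨ eval-cong (typableAt e nothing) (fvars-typableAt e nothing) (decode-typevarOf x) ⟩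
        eval (occurrences 𝒯 x) (typableAt e nothing)
          ≡⟨ cong (eval (occurrences 𝒯 x)) (sym (typableAt-generic e x∉S)) ⟩
        typable e 𝒯 x ∎

    isInstantiation : IsInstantiation Γ I
    isInstantiation =
      (λ _ _ _ _ a₁≢a₂ _ x∈₁ x∈₂ → a₁≢a₂ (trans (sym (proj₂ (∈-tyOf⁻ x∈₁))) (proj₂ (∈-tyOf⁻ x∈₂))))
      , (λ _ _ _ A∈S A∈ → proj₁ (∈-tyOf⁻ A∈) A∈S)
      , (λ _ _ r r∈ → proj₁ (∈-filterᵇ⁻ _ R r∈))
      , (λ A _ → to T-≡ (subst T (eval-cong (typableAt e (just A)) (fvars-typableAt e (just A))
                                             (occurs A)) (t A)))
      where
      occurs : ∀ A → Agree R (occurrences 𝒯 A) (indicator (relOf I A))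
      occurs A r r∈ = member≡ (⇔-sym (member⇔∈ (relOf I A)) ⇔-∘ ⇔-sym (∈-relOf⇔ {A} r∈))

    image≐ : ∀ r → r ∈ R → image Γ I r ≐ 𝒯 r
    image≐ r r∈ = (λ x → [ via-typevar , to (∈-relOf⇔ r∈) ∘ proj₂ ] ∘ ∈-image⁻ Γ I) , into-image
      where
      via-typevar : ∀ {x} → Σ TypeVar (λ a → a ∈ decl Γ r × x ∈ tyOf I a) → x ∈ 𝒯 r
      via-typevar {x} (a , a∈ , x∈a) =
        to (member⇔∈ (𝒯 r))
           (subst T (decode-typevarOf x r r∈)
                  (subst (λ j → T (decode R j r)) (sym (proj₂ (∈-tyOf⁻ x∈a))) (proj₂ (∈-decl⁻ a∈))))

      into-image : 𝒯 r ⊆ image Γ I r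
      into-image x x∈ with x ∈? S
      ... | yes x∈S = ∈-image⁺ˢᵖ Γ I x∈S (from (∈-relOf⇔ r∈) x∈)
      ... | no x∉S = ∈-image⁺ᵗʸ Γ I (∈-filterᵇ⁺ _ (typevarOf-∈ x∉S) occurs) (∈-tyOf⁺ r∈ x∈ x∉S)
        where
        occurs : T (decode R (typevarOf x) r)
        occurs = subst T (sym (decode-typevarOf x r r∈)) (from (member⇔∈ (𝒯 r)) x∈)

  InstantiationFor : TypeAssignment → Type → Set
  InstantiationFor 𝒯 τ =
    Σ Instantiation (λ I →
      IsInstantiation Γ I × (∀ r → r ∈ R → image Γ I r ≐ 𝒯 r) × (τ ≐ outputType F I))

  typing⇒instantiation : ∀ {𝒯 τ} → 𝒯 ⊢ e ∶ τ → InstantiationFor 𝒯 τ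
  typing⇒instantiation d =
    let t , rep = ⊢-sound d
    in instantiation t , isInstantiation t , image≐ t ,
       represents-≐ rep (represents-cong (output-cong e (image≐ t))
                                         (outputType-represents (isInstantiation t)))

  instantiation⇒typing : ∀ {𝒯 τ} → InstantiationFor 𝒯 τ → 𝒯 ⊢ e ∶ τ
  instantiation⇒typing (I , isI , image≐𝒯 , τ≐) =
    from ⊢⇔ ( (λ x → subst T (typable-cong e image≐𝒯 x) (image-typable isI x))
            , ≐-represents τ≐ (represents-cong (output-cong e image≐𝒯) (outputType-represents isI)))

theorem1 : (e : Expr) →
    Σ TypeFormula (λ F → IsTypeFormula F × expr F ≡ e × Principal F e)
theorem1 e = F , isTypeFormula , refl , λ _ _ → mk⇔ typing⇒instantiation instantiation⇒typing
  where open PrincipalTypeFormula e
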